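{- Let $k>4$ be an even integer. Assume that the last list passed to the callback by $\mathrm{Permutations}((0,1,\dots,k-1),0,\mathrm{Func})$ is $(1,4,3,5,6,7,8,\dots,k-1,2,0)$. Consider the call $\mathrm{Permutations}(L,0,\mathrm{Func})$ with $L=(0,1,2,\dots,k)$ (a list of $k+1$ elements). Then each of the $k+1$ elements $0,1,\dots,k$ occupies position $0$ of $L$ at the start of exactly one of the $k+1$ recursive calls $\mathrm{Permutations}(L,1,\mathrm{Func})$ made directly by this top-level call, and the last list passed to the callback is $(1,0,2,3,4,\dots,k)$, i.e. the initial sequence with its first two elements swapped.
   Context: Lists are 0-indexed and mutable. $\mathrm{extract}(L,j)$ removes the element at position $j$ of $L$ and returns it; $\mathrm{Insert}(L,i,x)$ inserts $x$ into $L$ so that it occupies position $i$, shifting later elements one position to the right. The recursive procedure $\mathrm{Permutations}(L,i,\mathrm{Func})$ is: let $n$ be the length of $L$. If $i\ge n-1$, call $\mathrm{Func}(L)$. Otherwise: (1) call $\mathrm{Permutations}(L,i+1,\mathrm{Func})$; (2) do $\mathrm{Insert}(L,i,\mathrm{extract}(L,i+1))$ and call $\mathrm{Permutations}(L,i+1,\mathrm{Func})$; (3) repeat $\max(n-i-3,0)$ times: if $n-i$ is even do $\mathrm{Insert}(L,i,\mathrm{extract}(L,n-1))$, else do $\mathrm{Insert}(L,i,\mathrm{extract}(L,i+1))$, then call $\mathrm{Permutations}(L,i+1,\mathrm{Func})$; (4) if $n-i>2$, do $\mathrm{Insert}(L,i,\mathrm{extract}(L,i+1))$ and call $\mathrm{Permutations}(L,i+1,\mathrm{Func})$.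 The procedure only moves elements by position, so its behaviour on a list $(e_0,\dots,e_{m-1})$ is obtained from its behaviour on $(0,\dots,m-1)$ by relabeling $j\mapsto e_j$. "Applying the algorithm" to a list means calling $\mathrm{Permutations}(L,0,\mathrm{Func})$; the lists passed to $\mathrm{Func}$ are the generated permutations, and the "last permutation" is the list passed to $\mathrm{Func}$ in its final invocation. -}

module Defs where

open import Data.Nat using (ℕ; zero; suc; _+_; _∸_; _≤?_; _<ᵇ_)
open import Data.Bool using (Bool; true; false; if_then_else_)
open import Data.List using (List; []; _∷_; _++_; length; map; filter; head; last; upTo)
open import Data.Product using (_×_; _,_; proj₁; proj₂)
open import Data.Maybe using (Maybe; just; nothing)
open import Relation.Nullary using (yes; no)

-- extract(L,j): remove the element at position j, returning it and the rest.
-- (nothing if j is out of range; never happens in the algorithm)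
extract : ℕ → List ℕ → Maybe (ℕ × List ℕ)
extract j       []       = nothing
extract zero    (x ∷ xs) = just (x , xs)
extract (suc j) (x ∷ xs) with extract j xs
... | nothing       = nothing
... | just (y , ys) = just (y , x ∷ ys)

insertAt : ℕ → ℕ → List ℕ → List ℕ
insertAt zero    x ys       = x ∷ ys
insertAt (suc i) x []       = x ∷ []
insertAt (suc i) x (y ∷ ys) = y ∷ insertAt i x ys

-- Insert(L, i, extract(L, j))   (no-op if j is out of range)
move : ℕ → ℕ → List ℕ → List ℕ
move j i L with extract j L
... | nothing       = L
... | just (x , L') = insertAt i x L'

isEven : ℕ → Bool
isEven zero          = true
isEven (suc zero)    = false
isEven (suc (suc n)) = isEven n

-- Trace of a run of Permutations:
--   final   : the state of the (mutable) list L when the call returns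
--   outputs : the lists passed to Func, in order
--   calls   : every invocation Permutations(L,i,Func) (including the
--             outermost one), in order of invocation, recorded as
--             (i , state of L at the start of that invocation)
record Result : Set where
  constructor result
  field
    final   : List ℕ
    outputs : List (List ℕ)
    calls   : List (ℕ × List ℕ)
open Result public

andThen : Result → (List ℕ → Result) → Result
andThen r k with k (final r)
... | r' = result (final r') (outputs r ++ outputs r') (calls r ++ calls r')

repeatStep : ℕ → (List ℕ → Result) → Result → Result
repeatStep zero    step r = r
repeatStep (suc c) step r = repeatStep c step (andThen r step)

-- Permutations(L,i,Func), with a fuel argument for termination.
-- Fuel length L suffices starting from i = 0 (recursion depth ≤ n - 1).
go : ℕ → ℕ → List ℕ → Result
go fuel i L with (length L ∸ 1) ≤? i
go fuel i L | yes _ = result L (L ∷ []) ((i , L) ∷ [])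
go zero i L | no _  = result L (L ∷ []) ((i , L) ∷ [])
go (suc f) i L | no _ =
  let n    = length L
      rec  = go f (suc i)
      r1   = rec L
      r2   = andThen r1 (λ M → rec (move (suc i) i M))
      mv3  = if isEven (n ∸ i) then move (n ∸ 1) i else move (suc i) i
      r3   = repeatStep ((n ∸ i) ∸ 3) (λ M → rec (mv3 M)) r2
      r4   = if 2 <ᵇ (n ∸ i) then andThen r3 (λ M → rec (move (suc i) i M)) else r3
  in result (final r4) (outputs r4) ((i , L) ∷ calls r4)

Permutations : List ℕ → Result
Permutations L = go (length L) 0 L

-- lists L at the start of the calls Permutations(L,1,Func); when the
-- outermost call has i = 0, these are exactly the calls made directly by it
depthOneStarts : Result → List (List ℕ)
depthOneStarts r = map proj₂ (filter (λ c → proj₁ c Data.Nat.≟ 1) (calls r))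

{-# OPTIONS --safe #-}
module Submission where

-- Since the top-level call on U = (0, …, k) has n − i = k + 1 odd, each of its moves swaps
-- the first two entries, so it runs k + 1 rounds M ↦ swap (final list of Permutations(M,1)).
-- Permutations(x ∷ M, 1) acts as Permutations(M, 0) on the tail and commutes with relabelling
-- the entries, so the hypothesis on the run over k elements shows that a round sends
-- (g 0, …, g k) to (g (σ 0), …, g (σ k)) for one fixed σ.  The orbit of 0 under σ is the full
-- cycle 0 → 2 → 5 → 7 → ⋯ → k − 1 → 3 → 4 → 6 → ⋯ → k → 1 → 0: hence the rounds start with the
-- distinct heads σᶜ 0 (c ≤ k), and σ^(k+1) = id, so the last round ends with the list whose
-- swap is U, namely swap U.

open import Defs
open import Data.Bool using (Bool; true; false; if_then_else_)
open import Data.Empty using (⊥-elim)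
open import Data.List using (List; []; _∷_; _++_; _∷ʳ_; length; map; filter; head; last; upTo; applyUpTo; drop)
open import Data.List.Properties
  using (length-map; length-upTo; length-applyUpTo; map-++; map-∘; map-id; map-id-local; map-cong-local;
         map-upTo; map-applyUpTo; applyUpTo-∷ʳ; ++-assoc; ++-identityʳ;
         filter-++; filter-none; filter-accept; filter-reject)
open import Data.List.Relation.Unary.All as All using (All; []; _∷_)
open import Data.List.Relation.Unary.All.Properties using (++⁺; applyUpTo⁺₁)
open import Data.Maybe as Maybe using (just; nothing)
open import Data.Maybe.Properties using (≡-dec; just-injective)
open import Data.Nat using (ℕ; zero; suc; _+_; _*_; _∸_; _≤_; _<_; _≤?_; _<ᵇ_; _≟_; z≤n; s≤s; z<s; s<s; s≤s⁻¹)
open import Data.Nat.Divisibility using (_∣_; divides)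
open import Data.Nat.GeneralisedArithmetic using (iterate; fold; fold-+)
open import Data.Nat.Properties
  using (≤-refl; ≤-trans; <⇒≤; <⇒≢; <-irrefl; n≤1+n; m≤m+n; m≤n+m; m≤n⇒m≤1+n; m∸n≤m;
         +-suc; +-comm; +-identityʳ; *-comm; +-monoʳ-≤; +-cancelˡ-≤; +-∸-assoc; [m+n]∸[m+o]≡n∸o;
         suc-injective; 0≢1+n; 1+n≢0)
open import Data.Product as Product using (Σ; ∃-syntax; _×_; _,_; proj₁; proj₂)
open import Function using (_∘_; id)
open import Relation.Binary.PropositionalEquality
open import Relation.Nullary using (¬_; Dec; yes; no)
open import Relation.Unary using (Decidable)

-- Lists, iteration and orbits

last-++ : ∀ {A : Set} (xs : List A) {ys y} → last ys ≡ just y → last (xs ++ ys) ≡ just y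
last-++ []            e = e
last-++ (x ∷ [])      {_ ∷ _} e = e
last-++ (x ∷ x′ ∷ xs) e = last-++ (x′ ∷ xs) e

iterate-∘ : ∀ {A B : Set} (f : B → A) (g : A → B) x c → iterate (f ∘ g) (f x) c ≡ f (iterate (g ∘ f) x c)
iterate-∘ f g x zero    = refl
iterate-∘ f g x (suc c) = iterate-∘ f g (g (f x)) c

module _ {A : Set} {P : A → Set} (P? : Decidable P) where

  count-unique : ∀ (f : ℕ → A) n a → a < n → P (f a) → (∀ j → j < n → P (f j) → j ≡ a) →
                 length (filter P? (applyUpTo f n)) ≡ 1
  count-unique f (suc n) zero    _         Pfa unique =
    trans (cong length (filter-accept P? Pfa)) (cong (suc ∘ length) (filter-none P? none))
    where
    none : All (¬_ ∘ P) (applyUpTo (f ∘ suc) n)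
    none = applyUpTo⁺₁ (f ∘ suc) n (λ {j} j<n Pj → 0≢1+n (sym (unique (suc j) (s<s j<n) Pj)))
  count-unique f (suc n) (suc a) (s<s a<n) Pfa unique =
    trans (cong length (filter-reject P? (λ Pf0 → 0≢1+n (unique 0 z<s Pf0))))
          (count-unique (f ∘ suc) n a a<n Pfa (λ j j<n Pj → suc-injective (unique (suc j) (s<s j<n) Pj)))

-- pos x is the number of q-steps from 0 to x on a q-cycle through all of 0 … N that closes at end.
record OrbitRank (q pos : ℕ → ℕ) (N : ℕ) : Set where
  field
    pos-0   : pos 0 ≡ 0
    pos-q   : ∀ y → pos y < N → pos (q y) ≡ suc (pos y)
    q-onto  : ∀ x → x ≤ N → x ≢ 0 → ∃[ y ] y ≤ N × pos y < N × q y ≡ x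
    end     : ℕ
    end≤N   : end ≤ N
    pos-end : pos end ≡ N
    q-end   : q end ≡ 0

module OrbitRankProperties {q pos N} (R : OrbitRank q pos N) where
  open OrbitRank R

  pos-fold : ∀ a → a ≤ N → pos (fold 0 q a) ≡ a
  pos-fold zero    _   = pos-0
  pos-fold (suc a) a<N = trans (pos-q _ (subst (_< N) (sym ih) a<N)) (cong suc ih)
    where
    ih : pos (fold 0 q a) ≡ a
    ih = pos-fold a (<⇒≤ a<N)

  pos-≤ : ∀ x → x ≤ N → pos x ≤ N
  pos-≤ x x≤N with x ≟ 0
  ... | yes refl = subst (_≤ N) (sym pos-0) z≤n
  ... | no x≢0 with q-onto x x≤N x≢0
  ...   | y , _ , pos-y<N , refl = subst (_≤ N) (sym (pos-q y pos-y<N)) pos-y<N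

  fold-pos : ∀ x → x ≤ N → fold 0 q (pos x) ≡ x
  fold-pos x x≤N = by-rank (pos x) x x≤N refl
    where
    by-rank : ∀ n x → x ≤ N → pos x ≡ n → fold 0 q n ≡ x
    by-rank zero    x x≤N e with x ≟ 0
    ... | yes refl = refl
    ... | no x≢0 with q-onto x x≤N x≢0
    ...   | y , _ , pos-y<N , refl = ⊥-elim (1+n≢0 (trans (sym (pos-q y pos-y<N)) e))
    by-rank (suc n) x x≤N e with x ≟ 0
    ... | yes refl = ⊥-elim (0≢1+n (trans (sym pos-0) e))
    ... | no x≢0 with q-onto x x≤N x≢0
    ...   | y , y≤N , pos-y<N , refl =
      cong q (by-rank n y y≤N (suc-injective (trans (sym (pos-q y pos-y<N)) e)))

  fold-inverse : ∀ y → y ≤ N → fold (q y) q N ≡ y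
  fold-inverse y y≤N = begin
    fold (q y) q N               ≡⟨ cong (λ z → fold (q z) q N) (sym (fold-pos y y≤N)) ⟩
    fold (fold 0 q (suc b)) q N  ≡⟨ sym (fold-+ 0 q N) ⟩
    fold 0 q (N + suc b)         ≡⟨ cong (fold 0 q) (trans (+-suc N b) (trans (cong suc (+-comm N b)) (sym (+-suc b N)))) ⟩
    fold 0 q (b + suc N)         ≡⟨ fold-+ 0 q b ⟩
    fold (fold 0 q (suc N)) q b  ≡⟨ cong (λ z → fold z q b) closes ⟩
    fold 0 q b                   ≡⟨ fold-pos y y≤N ⟩
    y                            ∎
    where
    open ≡-Reasoning
    b : ℕ
    b = pos y
    closes : fold 0 q (suc N) ≡ 0
    closes = trans (cong q (trans (cong (fold 0 q) (sym pos-end)) (fold-pos end end≤N))) q-end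

leaf : ℕ → List ℕ → Result
leaf i L = result L (L ∷ []) ((i , L) ∷ [])

enter : ℕ → List ℕ → Result → Result
enter i L r = result (final r) (outputs r) ((i , L) ∷ calls r)

-- Steps (1)–(4) of Permutations(L,i): rec is the recursive call, mv the move of steps (2) and (4),
-- mv₃ the move of step (3), made c times, and b tells whether step (4) happens.
sweepBody : (List ℕ → Result) → (List ℕ → List ℕ) → (List ℕ → List ℕ) → ℕ → Bool → List ℕ → Result
sweepBody rec mv mv₃ c b L =
  if b then andThen (repeatStep c (rec ∘ mv₃) (andThen (rec L) (rec ∘ mv))) (rec ∘ mv)
       else repeatStep c (rec ∘ mv₃) (andThen (rec L) (rec ∘ mv))

-- Opaque because andThen copies its first argument: unfolding sweepBody during
-- with-abstraction or conversion checking takes exponential time.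
opaque
  sweep : (List ℕ → Result) → (List ℕ → List ℕ) → (List ℕ → List ℕ) → ℕ → Bool → List ℕ → Result
  sweep = sweepBody

  sweep-unfold : ∀ rec mv mv₃ c b L → sweep rec mv mv₃ c b L ≡ sweepBody rec mv mv₃ c b L
  sweep-unfold rec mv mv₃ c b L = refl

step₃Move : ℕ → ℕ → List ℕ → List ℕ
step₃Move n i = if isEven (n ∸ i) then move (n ∸ 1) i else move (suc i) i

sweepAt : ℕ → ℕ → List ℕ → Result
sweepAt f i L =
  sweep (go f (suc i)) (move (suc i) i) (step₃Move (length L) i) ((length L ∸ i) ∸ 3) (2 <ᵇ (length L ∸ i)) L

go-leaf : ∀ f i L → length L ∸ 1 ≤ i → go f i L ≡ leaf i L
go-leaf f i L p with (length L ∸ 1) ≤? i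
go-leaf f       i L p | yes _ = refl
go-leaf zero    i L p | no _  = refl
go-leaf (suc f) i L p | no ¬p = ⊥-elim (¬p p)

go-zero : ∀ i L → go zero i L ≡ leaf i L
go-zero i L with (length L ∸ 1) ≤? i
... | yes _ = refl
... | no _  = refl

go-suc : ∀ f i L → ¬ (length L ∸ 1 ≤ i) → go (suc f) i L ≡ enter i L (sweepAt f i L)
go-suc f i L ¬p with (length L ∸ 1) ≤? i
... | yes p = ⊥-elim (¬p p)
... | no _  = cong (enter i L) (sym (sweep-unfold (go f (suc i)) (move (suc i) i) (step₃Move (length L) i)
                                                   ((length L ∸ i) ∸ 3) (2 <ᵇ (length L ∸ i)) L))

module _ (P : ℕ → ℕ → List ℕ → Result → Set)
         (P-leaf  : ∀ f i L → length L ∸ 1 ≤ i → P f i L (leaf i L))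
         (P-empty : ∀ i L → P zero i L (leaf i L))
         (P-enter : ∀ f i L → ¬ (length L ∸ 1 ≤ i) → (∀ M → P f (suc i) M (go f (suc i) M)) →
                    P (suc f) i L (enter i L (sweepAt f i L))) where

  go-ind : ∀ f i L → P f i L (go f i L)
  go-ind f i L = by-cases f ((length L ∸ 1) ≤? i)
    where
    by-cases : ∀ f → Dec (length L ∸ 1 ≤ i) → P f i L (go f i L)
    by-cases f       (yes p) = subst (P f i L) (sym (go-leaf f i L p)) (P-leaf f i L p)
    by-cases zero    (no _)  = subst (P zero i L) (sym (go-zero i L)) (P-empty i L)
    by-cases (suc f) (no ¬p) =
      subst (P (suc f) i L) (sym (go-suc f i L ¬p)) (P-enter f i L ¬p (go-ind f (suc i)))

module _ (P : Result → Set) (P-andThen : ∀ {r} k → (∀ M → P (k M)) → P r → P (andThen r k)) where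

  repeatStep-preserves : ∀ c {step r} → (∀ M → P (step M)) → P r → P (repeatStep c step r)
  repeatStep-preserves zero    P-step Pr = Pr
  repeatStep-preserves (suc c) P-step Pr = repeatStep-preserves c P-step (P-andThen _ P-step Pr)

  sweep-preserves : ∀ {rec} mv mv₃ c b L → (∀ M → P (rec M)) → P (sweep rec mv mv₃ c b L)
  sweep-preserves {rec} mv mv₃ c b L P-rec = subst P (sym (sweep-unfold rec mv mv₃ c b L)) (by-cases b)
    where
    r₃-preserves : P (repeatStep c (rec ∘ mv₃) (andThen (rec L) (rec ∘ mv)))
    r₃-preserves = repeatStep-preserves c (P-rec ∘ mv₃) (P-andThen _ (P-rec ∘ mv) (P-rec L))
    by-cases : ∀ b → P (sweepBody rec mv mv₃ c b L)
    by-cases false = r₃-preserves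
    by-cases true  = P-andThen _ (P-rec ∘ mv) r₃-preserves

  sweepAt-preserves : ∀ f i L → (∀ M → P (go f (suc i) M)) → P (sweepAt f i L)
  sweepAt-preserves f i L =
    sweep-preserves (move (suc i) i) (step₃Move (length L) i) ((length L ∸ i) ∸ 3) (2 <ᵇ (length L ∸ i)) L

LastIsFinal : Result → Set
LastIsFinal r = last (outputs r) ≡ just (final r)

last-outputs-go : ∀ f i L → LastIsFinal (go f i L)
last-outputs-go = go-ind (λ _ _ _ → LastIsFinal) (λ _ _ _ _ → refl) (λ _ _ → refl)
  (λ f i L _ → sweepAt-preserves LastIsFinal (λ {r} k Pk _ → last-++ (outputs r) (Pk (final r))) f i L)

OpensAt : ℕ → List ℕ → Result → Set
OpensAt i L r = Σ (List (ℕ × List ℕ)) λ cs → calls r ≡ (i , L) ∷ cs × All ((i <_) ∘ proj₁) cs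

calls-go : ∀ f i L → OpensAt i L (go f i L)
calls-go = go-ind (λ _ → OpensAt) (λ _ _ _ _ → [] , refl , []) (λ _ _ → [] , refl , [])
  (λ f i L _ IH → calls (sweepAt f i L) , refl ,
    sweepAt-preserves (All ((i <_) ∘ proj₁) ∘ calls) (λ {r} k Pk Pr → ++⁺ Pr (Pk (final r))) f i L
      (λ M → deeper (go f (suc i) M) (IH M)))
  where
  deeper : ∀ {i M} r → OpensAt (suc i) M r → All ((i <_) ∘ proj₁) (calls r)
  deeper r (cs , e , all) rewrite e = ≤-refl ∷ All.map <⇒≤ all

depthOneStarts-go : ∀ f M → depthOneStarts (go f 1 M) ≡ M ∷ []
depthOneStarts-go f M =
  let cs , e , deeper = calls-go f 1 M in
  trans (cong (map proj₂ ∘ filter (λ c → proj₁ c ≟ 1)) e)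
        (cong (λ cs′ → M ∷ map proj₂ cs′) (filter-none (λ c → proj₁ c ≟ 1) (All.map (λ p e → <⇒≢ p (sym e)) deeper)))

depthOneStarts-andThen : ∀ r k → depthOneStarts (andThen r k) ≡ depthOneStarts r ++ depthOneStarts (k (final r))
depthOneStarts-andThen r k =
  trans (cong (map proj₂) (filter-++ (λ c → proj₁ c ≟ 1) (calls r) (calls (k (final r)))))
        (map-++ proj₂ (filter (λ c → proj₁ c ≟ 1) (calls r)) (filter (λ c → proj₁ c ≟ 1) (calls (k (final r)))))

-- Naturality: relabelling the entries and prepending a fixed entry

module Natural (φ : List ℕ → List ℕ) where

  record _≈_ (r₁ r₂ : Result) : Set where
    constructor tracks
    field final-≈ : final r₁ ≡ φ (final r₂)
  open _≈_ public

  andThen-natural : ∀ {r₁ r₂} k₁ k₂ → r₁ ≈ r₂ → (∀ M → k₁ (φ M) ≈ k₂ M) → andThen r₁ k₁ ≈ andThen r₂ k₂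
  andThen-natural {r₂ = r₂} k₁ k₂ (tracks e) ek = tracks (trans (cong (final ∘ k₁) e) (final-≈ (ek (final r₂))))

  repeatStep-natural : ∀ c {r₁ r₂} s₁ s₂ → r₁ ≈ r₂ → (∀ M → s₁ (φ M) ≈ s₂ M) →
                       repeatStep c s₁ r₁ ≈ repeatStep c s₂ r₂
  repeatStep-natural zero    s₁ s₂ e es = e
  repeatStep-natural (suc c) s₁ s₂ e es = repeatStep-natural c s₁ s₂ (andThen-natural s₁ s₂ e es) es

  sweep-natural : ∀ {c₁ c₂ b₁ b₂} rec₁ rec₂ mv₁ mv₂ mv₃₁ mv₃₂ L → c₁ ≡ c₂ → b₁ ≡ b₂ →
    (∀ M → rec₁ (φ M) ≈ rec₂ M) → (∀ M → mv₁ (φ M) ≡ φ (mv₂ M)) → (∀ M → mv₃₁ (φ M) ≡ φ (mv₃₂ M)) →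
    sweep rec₁ mv₁ mv₃₁ c₁ b₁ (φ L) ≈ sweep rec₂ mv₂ mv₃₂ c₂ b₂ L
  sweep-natural {c} {b₁ = b} rec₁ rec₂ mv₁ mv₂ mv₃₁ mv₃₂ L refl refl e-rec e-mv e-mv₃ =
    subst₂ _≈_ (sym (sweep-unfold rec₁ mv₁ mv₃₁ c b (φ L))) (sym (sweep-unfold rec₂ mv₂ mv₃₂ c b L)) (by-cases b)
    where
    after : ∀ mv₁ mv₂ → (∀ M → mv₁ (φ M) ≡ φ (mv₂ M)) → ∀ M → rec₁ (mv₁ (φ M)) ≈ rec₂ (mv₂ M)
    after mv₁ mv₂ e-mv M = tracks (trans (cong (final ∘ rec₁) (e-mv M)) (final-≈ (e-rec (mv₂ M))))
    r₃-natural : repeatStep c (rec₁ ∘ mv₃₁) (andThen (rec₁ (φ L)) (rec₁ ∘ mv₁))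
               ≈ repeatStep c (rec₂ ∘ mv₃₂) (andThen (rec₂ L) (rec₂ ∘ mv₂))
    r₃-natural = repeatStep-natural c (rec₁ ∘ mv₃₁) (rec₂ ∘ mv₃₂)
      (andThen-natural (rec₁ ∘ mv₁) (rec₂ ∘ mv₂) (e-rec L) (after mv₁ mv₂ e-mv)) (after mv₃₁ mv₃₂ e-mv₃)
    by-cases : ∀ b → sweepBody rec₁ mv₁ mv₃₁ c b (φ L) ≈ sweepBody rec₂ mv₂ mv₃₂ c b L
    by-cases false = r₃-natural
    by-cases true  = andThen-natural (rec₁ ∘ mv₁) (rec₂ ∘ mv₂) r₃-natural (after mv₁ mv₂ e-mv)

  module _ (d : ℕ) (length-φ : ∀ M → length (φ M) ≡ d + length M)
           (move-φ : ∀ j i M → move (d + j) (d + i) (φ M) ≡ φ (move j i M)) where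

    private
      leaf-shift : ∀ {n i} → n ∸ 1 ≤ i → (d + n) ∸ 1 ≤ d + i
      leaf-shift {zero}  _ = ≤-trans (m∸n≤m (d + 0) 1) (+-monoʳ-≤ d z≤n)
      leaf-shift {suc n} p rewrite +-suc d n = +-monoʳ-≤ d p

      enter-shift : ∀ {n i} → ¬ (n ∸ 1 ≤ i) → ¬ ((d + n) ∸ 1 ≤ d + i)
      enter-shift {zero}  ¬p _ = ¬p z≤n
      enter-shift {suc n} ¬p p rewrite +-suc d n = ¬p (+-cancelˡ-≤ d _ _ p)

      nonempty : ∀ {n i} → ¬ (n ∸ 1 ≤ i) → 1 ≤ n
      nonempty {zero}  ¬p = ⊥-elim (¬p z≤n)
      nonempty {suc n} _  = s≤s z≤n

      move-φ-next : ∀ i M → move (suc (d + i)) (d + i) (φ M) ≡ φ (move (suc i) i M)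
      move-φ-next i M = subst (λ j → move j (d + i) (φ M) ≡ φ (move (suc i) i M)) (+-suc d i) (move-φ (suc i) i M)

      step₃Move-φ : ∀ n i → 1 ≤ n → ∀ M → step₃Move (d + n) (d + i) (φ M) ≡ φ (step₃Move n i M)
      step₃Move-φ n i 1≤n M rewrite [m+n]∸[m+o]≡n∸o d n i with isEven (n ∸ i)
      ... | true  rewrite +-∸-assoc d 1≤n = move-φ (n ∸ 1) i M
      ... | false = move-φ-next i M

      sweepAt-natural : ∀ f i L → ¬ (length L ∸ 1 ≤ i) → (∀ M → go f (d + suc i) (φ M) ≈ go f (suc i) M) →
                        sweepAt f (d + i) (φ L) ≈ sweepAt f i L
      sweepAt-natural f i L ¬p IH =
        sweep-natural (go f (suc (d + i))) (go f (suc i)) (move (suc (d + i)) (d + i)) (move (suc i) i)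
                      (step₃Move (length (φ L)) (d + i)) (step₃Move (length L) i) L
                      (cong (_∸ 3) gap) (cong (2 <ᵇ_) gap) rec-≈ (move-φ-next i) step₃-≡
        where
        gap : length (φ L) ∸ (d + i) ≡ length L ∸ i
        gap = trans (cong (_∸ (d + i)) (length-φ L)) ([m+n]∸[m+o]≡n∸o d (length L) i)
        rec-≈ : ∀ M → go f (suc (d + i)) (φ M) ≈ go f (suc i) M
        rec-≈ M = subst (λ j → go f j (φ M) ≈ go f (suc i) M) (+-suc d i) (IH M)
        step₃-≡ : ∀ M → step₃Move (length (φ L)) (d + i) (φ M) ≡ φ (step₃Move (length L) i M)
        step₃-≡ M = subst (λ n → step₃Move n (d + i) (φ M) ≡ φ (step₃Move (length L) i M))
                          (sym (length-φ L)) (step₃Move-φ (length L) i (nonempty ¬p) M)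

    go-natural : ∀ f i L → go f (d + i) (φ L) ≈ go f i L
    go-natural = go-ind (λ f i L r → go f (d + i) (φ L) ≈ r)
      (λ f i L p → tracks (cong final (go-leaf f (d + i) (φ L) (length-φ-leaf L p))))
      (λ i L → tracks (cong final (go-zero (d + i) (φ L))))
      (λ f i L ¬p IH → tracks (trans (cong final (go-suc f (d + i) (φ L) (length-φ-enter L ¬p)))
                                     (final-≈ (sweepAt-natural f i L ¬p IH))))
      where
      length-φ-leaf : ∀ {i} L → length L ∸ 1 ≤ i → length (φ L) ∸ 1 ≤ d + i
      length-φ-leaf {i} L p = subst (λ n → n ∸ 1 ≤ d + i) (sym (length-φ L)) (leaf-shift p)
      length-φ-enter : ∀ {i} L → ¬ (length L ∸ 1 ≤ i) → ¬ (length (φ L) ∸ 1 ≤ d + i)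
      length-φ-enter {i} L ¬p = subst (λ n → ¬ (n ∸ 1 ≤ d + i)) (sym (length-φ L)) (enter-shift ¬p)

extract-map : ∀ (g : ℕ → ℕ) j L → extract j (map g L) ≡ Maybe.map (Product.map g (map g)) (extract j L)
extract-map g j       []      = refl
extract-map g zero    (x ∷ L) = refl
extract-map g (suc j) (x ∷ L) rewrite extract-map g j L with extract j L
... | nothing       = refl
... | just (y , ys) = refl

insertAt-map : ∀ (g : ℕ → ℕ) i y ys → insertAt i (g y) (map g ys) ≡ map g (insertAt i y ys)
insertAt-map g zero    y ys       = refl
insertAt-map g (suc i) y []       = refl
insertAt-map g (suc i) y (z ∷ ys) = cong (g z ∷_) (insertAt-map g i y ys)

move-map : ∀ (g : ℕ → ℕ) j i L → move j i (map g L) ≡ map g (move j i L)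
move-map g j i L rewrite extract-map g j L with extract j L
... | nothing       = refl
... | just (y , ys) = insertAt-map g i y ys

move-∷ : ∀ x j i M → move (suc j) (suc i) (x ∷ M) ≡ x ∷ move j i M
move-∷ x j i M with extract j M
... | nothing       = refl
... | just (y , ys) = refl

final-go-map : ∀ (g : ℕ → ℕ) f i L → final (go f i (map g L)) ≡ map g (final (go f i L))
final-go-map g f i L = final-≈ (go-natural 0 (length-map g) (move-map g) f i L)
  where open Natural (map g)

final-go-∷ : ∀ x f i L → final (go f (suc i) (x ∷ L)) ≡ x ∷ final (go f i L)
final-go-∷ x f i L = final-≈ (go-natural 1 (λ _ → refl) (move-∷ x) f i L)
  where open Natural (x ∷_)

-- The top-level call on a list of odd length

swap : List ℕ → List ℕ
swap = move 1 0

swap-involutive : ∀ L → swap (swap L) ≡ L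
swap-involutive []          = refl
swap-involutive (x ∷ [])    = refl
swap-involutive (x ∷ y ∷ L) = refl

andThen-repeatStep : ∀ c step r → andThen (repeatStep c step r) step ≡ repeatStep (suc c) step r
andThen-repeatStep zero    step r = refl
andThen-repeatStep (suc c) step r = andThen-repeatStep c step (andThen r step)

sweep-swaps : ∀ rec c {b} L → b ≡ true → sweep rec swap swap c b L ≡ repeatStep (suc (suc c)) (rec ∘ swap) (rec L)
sweep-swaps rec c L refl = trans (sweep-unfold rec swap swap c true L) (andThen-repeatStep (suc c) (rec ∘ swap) (rec L))

Permutations-odd : ∀ k L → length L ≡ suc k → 2 ≤ k → isEven (suc k) ≡ false →
                   Permutations L ≡ enter 0 L (repeatStep k (go k 1 ∘ swap) (go k 1 L))
Permutations-odd k@(suc (suc k′)) L len _ odd = begin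
  go (length L) 0 L                                     ≡⟨ cong (λ f → go f 0 L) len ⟩
  go (suc k) 0 L                                        ≡⟨ go-suc k 0 L long ⟩
  enter 0 L (sweepAt k 0 L)                             ≡⟨ cong (λ n → enter 0 L (sweep (go k 1) swap (step₃Move n 0)
                                                                                   ((n ∸ 0) ∸ 3) (2 <ᵇ (n ∸ 0)) L)) len ⟩
  enter 0 L (sweep (go k 1) swap (step₃Move (suc k) 0) k′ true L)
                                                        ≡⟨ cong (λ mv → enter 0 L (sweep (go k 1) swap mv k′ true L)) step₃-swap ⟩
  enter 0 L (sweep (go k 1) swap swap k′ true L)        ≡⟨ cong (enter 0 L) (sweep-swaps (go k 1) k′ L refl) ⟩
  enter 0 L (repeatStep k (go k 1 ∘ swap) (go k 1 L))  ∎
  where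
  open ≡-Reasoning
  long : ¬ (length L ∸ 1 ≤ 0)
  long p with subst (λ n → n ∸ 1 ≤ 0) len p
  ... | ()
  step₃-swap : step₃Move (suc k) 0 ≡ swap
  step₃-swap = cong (λ b → if b then move k 0 else swap) odd

repeatStep-final : ∀ c step r → final (repeatStep c step r) ≡ iterate (final ∘ step) (final r) c
repeatStep-final zero    step r = refl
repeatStep-final (suc c) step r = repeatStep-final c step (andThen r step)

depthOneStarts-repeatStep : ∀ rec h → (∀ M → depthOneStarts (rec M) ≡ M ∷ []) → ∀ c r →
  depthOneStarts (repeatStep c (rec ∘ h) r) ≡ depthOneStarts r ++ applyUpTo (iterate (h ∘ final ∘ rec) (h (final r))) c
depthOneStarts-repeatStep rec h starts-rec zero    r = sym (++-identityʳ (depthOneStarts r))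
depthOneStarts-repeatStep rec h starts-rec (suc c) r = begin
  depthOneStarts (repeatStep c (rec ∘ h) (andThen r (rec ∘ h)))
    ≡⟨ depthOneStarts-repeatStep rec h starts-rec c (andThen r (rec ∘ h)) ⟩
  depthOneStarts (andThen r (rec ∘ h)) ++ rest
    ≡⟨ cong (_++ rest) (trans (depthOneStarts-andThen r (rec ∘ h)) (cong (depthOneStarts r ++_) (starts-rec (h (final r))))) ⟩
  (depthOneStarts r ++ h (final r) ∷ []) ++ rest
    ≡⟨ ++-assoc (depthOneStarts r) (h (final r) ∷ []) rest ⟩
  depthOneStarts r ++ applyUpTo (iterate (h ∘ final ∘ rec) (h (final r))) (suc c) ∎
  where
  open ≡-Reasoning
  rest : List (List ℕ)
  rest = applyUpTo (iterate (h ∘ final ∘ rec) (h (final (rec (h (final r)))))) c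

round : ℕ → List ℕ → List ℕ
round k = swap ∘ final ∘ go k 1

module TopCall (k : ℕ) (U : List ℕ) (len : length U ≡ suc k) (2≤k : 2 ≤ k) (odd : isEven (suc k) ≡ false) where

  depthOneStarts-top : depthOneStarts (Permutations U) ≡ applyUpTo (iterate (round k) U) (suc k)
  depthOneStarts-top = trans (cong depthOneStarts (Permutations-odd k U len 2≤k odd))
    (trans (depthOneStarts-repeatStep (go k 1) swap (depthOneStarts-go k) k (go k 1 U))
           (cong (_++ applyUpTo (iterate (round k) (round k U)) k) (depthOneStarts-go k U)))

  final-top : final (Permutations U) ≡ final (go k 1 (iterate (round k) U k))
  final-top = trans (cong final (Permutations-odd k U len 2≤k odd))
    (trans (repeatStep-final k (go k 1 ∘ swap) (go k 1 U)) (iterate-∘ (final ∘ go k 1) swap U k))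

module Rounds (k : ℕ) (P : List ℕ) (final-k : final (go k 0 (upTo k)) ≡ P)
              (q : ℕ → ℕ) (q-P : map q (upTo (suc k)) ≡ swap (0 ∷ map suc P)) where

  final-go-1-map : ∀ g → final (go k 1 (map g (upTo (suc k)))) ≡ g 0 ∷ map (g ∘ suc) P
  final-go-1-map g = begin
    final (go k 1 (g 0 ∷ map g (applyUpTo suc k)))  ≡⟨ final-go-∷ (g 0) k 0 (map g (applyUpTo suc k)) ⟩
    g 0 ∷ final (go k 0 (map g (applyUpTo suc k)))  ≡⟨ cong (λ M → g 0 ∷ final (go k 0 M)) tail-map ⟩
    g 0 ∷ final (go k 0 (map (g ∘ suc) (upTo k)))   ≡⟨ cong (g 0 ∷_) (final-go-map (g ∘ suc) k 0 (upTo k)) ⟩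
    g 0 ∷ map (g ∘ suc) (final (go k 0 (upTo k)))   ≡⟨ cong (λ L → g 0 ∷ map (g ∘ suc) L) final-k ⟩
    g 0 ∷ map (g ∘ suc) P                           ∎
    where
    open ≡-Reasoning
    tail-map : map g (applyUpTo suc k) ≡ map (g ∘ suc) (upTo k)
    tail-map = trans (map-applyUpTo suc g k) (sym (map-upTo (g ∘ suc) k))

  round-map : ∀ g → round k (map g (upTo (suc k))) ≡ map (g ∘ q) (upTo (suc k))
  round-map g = begin
    swap (final (go k 1 (map g (upTo (suc k)))))  ≡⟨ cong swap (final-go-1-map g) ⟩
    swap (g 0 ∷ map (g ∘ suc) P)                  ≡⟨ cong (λ L → swap (g 0 ∷ L)) (map-∘ P) ⟩
    swap (map g (0 ∷ map suc P))                  ≡⟨ move-map g 1 0 (0 ∷ map suc P) ⟩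
    map g (swap (0 ∷ map suc P))                  ≡⟨ cong (map g) (sym q-P) ⟩
    map g (map q (upTo (suc k)))                  ≡⟨ sym (map-∘ (upTo (suc k))) ⟩
    map (g ∘ q) (upTo (suc k))                    ∎
    where open ≡-Reasoning

  iterate-round-map : ∀ c g → iterate (round k) (map g (upTo (suc k))) c ≡ map (λ y → g (fold y q c)) (upTo (suc k))
  iterate-round-map zero    g = refl
  iterate-round-map (suc c) g = trans (cong (λ L → iterate (round k) L c) (round-map g)) (iterate-round-map c (g ∘ q))

  iterate-round : ∀ c → iterate (round k) (upTo (suc k)) c ≡ map (λ y → fold y q c) (upTo (suc k))
  iterate-round c = trans (cong (λ L → iterate (round k) L c) (sym (map-id (upTo (suc k))))) (iterate-round-map c id)

-- The cycle σ

-- Where 4 + j lies relative to the last two positions 5 + m and 6 + m.  Positions beyond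
-- 6 + m count as inner, so that they too move up by two and rank-next holds for them.
data Zone (m : ℕ) : ℕ → Set where
  inner       : ∀ {j} → Zone m j
  penultimate : Zone m (1 + m)
  ultimate    : Zone m (2 + m)

shiftZone : ∀ {m j} → Zone m j → Zone (suc m) (suc j)
shiftZone inner       = inner
shiftZone penultimate = penultimate
shiftZone ultimate    = ultimate

zone : ∀ m j → Zone m j
zone zero    (suc zero)       = penultimate
zone zero    (suc (suc zero)) = ultimate
zone (suc m) (suc j)          = shiftZone (zone m j)
zone _       _                = inner

zone-inner : ∀ {m j} → j ≤ m → zone m j ≡ inner
zone-inner {zero}  {zero}  z≤n     = refl
zone-inner {suc m} {zero}  z≤n     = refl
zone-inner {suc m} {suc j} (s≤s p) = cong shiftZone (zone-inner p)

zone-penultimate : ∀ m → zone m (1 + m) ≡ penultimate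
zone-penultimate zero    = refl
zone-penultimate (suc m) = cong shiftZone (zone-penultimate m)

zone-ultimate : ∀ m → zone m (2 + m) ≡ ultimate
zone-ultimate zero    = refl
zone-ultimate (suc m) = cong shiftZone (zone-ultimate m)

jump : ∀ {m j} → Zone m j → ℕ
jump {j = j} inner = 6 + j
jump penultimate   = 3
jump ultimate      = 1

-- σ of the header for k = 6 + 2t: the entries of swap (0 ∷ map suc P), P = (1,4,3,5,6,…,k−1,2,0).
next : ℕ → ℕ → ℕ
next t 0 = 2
next t 1 = 0
next t 2 = 5
next t 3 = 4
next t (suc (suc (suc (suc j)))) = jump (zone (t + t) j)

-- The number of σ-steps from 0 to x.
rank : ℕ → ℕ → ℕ
rank t 0 = 0
rank t 1 = 6 + (t + t)
rank t 2 = 1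
rank t 3 = 3 + t
rank t 4 = 4 + t
rank t 5 = 2
rank t (suc (suc x@(suc (suc (suc (suc _)))))) = suc (rank t x)

module _ (t : ℕ) where

  rank-odd : ∀ i → rank t (5 + (i + i)) ≡ 2 + i
  rank-odd zero    = refl
  rank-odd (suc i) rewrite +-suc i i = cong suc (rank-odd i)

  rank-even : ∀ i → rank t (4 + (i + i)) ≡ 4 + (i + t)
  rank-even zero    = refl
  rank-even (suc i) rewrite +-suc i i = cong suc (rank-even i)

  rank-inner-≤ : ∀ i j → j ≤ i + i → rank t (4 + j) ≤ 4 + (i + t)
  rank-inner-≤ i       zero          _       = s≤s (s≤s (s≤s (s≤s (m≤n+m t i))))
  rank-inner-≤ i       (suc zero)    _       = s≤s (s≤s z≤n)
  rank-inner-≤ (suc i) (suc (suc j)) (s≤s p) rewrite +-suc i i = s≤s (rank-inner-≤ i j (s≤s⁻¹ p))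

  below : ∀ {p} → p ≤ 4 + (t + t) → p < 6 + (t + t)
  below p = s≤s (m≤n⇒m≤1+n p)

  rank-jump : ∀ {j} (z : Zone (t + t) j) → rank t (jump z) ≡ suc (rank t (4 + j))
  rank-jump inner       = refl
  rank-jump penultimate = cong suc (sym (rank-odd t))
  rank-jump ultimate    = cong (suc ∘ suc) (sym (rank-even t))

  rank-next : ∀ y → rank t y < 6 + (t + t) → rank t (next t y) ≡ suc (rank t y)
  rank-next 0 _ = refl
  rank-next 1 p = ⊥-elim (<-irrefl refl p)
  rank-next 2 _ = refl
  rank-next 3 _ = refl
  rank-next (suc (suc (suc (suc j)))) _ = rank-jump (zone (t + t) j)

  next-onto : ∀ x → x ≤ 6 + (t + t) → x ≢ 0 → ∃[ y ] y ≤ 6 + (t + t) × rank t y < 6 + (t + t) × next t y ≡ x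
  next-onto 0 _ x≢0 = ⊥-elim (x≢0 refl)
  next-onto 1 _ _ =
    6 + (t + t) , ≤-refl , subst (_< 6 + (t + t)) (cong suc (sym (rank-even t))) ≤-refl , cong jump (zone-ultimate (t + t))
  next-onto 2 _ _ = 0 , z≤n , z<s , refl
  next-onto 3 _ _ =
    5 + (t + t) , n≤1+n _ , below (subst (_≤ 4 + (t + t)) (sym (rank-odd t)) 2+t≤) , cong jump (zone-penultimate (t + t))
    where
    2+t≤ : 2 + t ≤ 4 + (t + t)
    2+t≤ = s≤s (s≤s (≤-trans (m≤m+n t t) (m≤n+m (t + t) 2)))
  next-onto 4 _ _ = 3 , s≤s (s≤s (s≤s z≤n)) , below (s≤s (s≤s (s≤s (m≤n⇒m≤1+n (m≤m+n t t))))) , refl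
  next-onto 5 _ _ = 2 , s≤s (s≤s z≤n) , below (s≤s z≤n) , refl
  next-onto (suc (suc (suc (suc (suc (suc j)))))) (s≤s (s≤s (s≤s (s≤s (s≤s (s≤s j≤)))))) _ =
    4 + j , s≤s (s≤s (s≤s (s≤s (≤-trans j≤ (m≤n+m (t + t) 2))))) , below (rank-inner-≤ t j j≤) , cong jump (zone-inner j≤)

  next-orbitRank : OrbitRank (next t) (rank t) (6 + (t + t))
  next-orbitRank = record
    { pos-0 = refl ; pos-q = rank-next ; q-onto = next-onto
    ; end = 1 ; end≤N = s≤s z≤n ; pos-end = refl ; q-end = refl }

  next-relabels : map (next t) (upTo (7 + (t + t)))
                  ≡ swap (0 ∷ map suc (1 ∷ 4 ∷ 3 ∷ (map (5 +_) (upTo (6 + (t + t) ∸ 5)) ++ 2 ∷ 0 ∷ [])))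
  next-relabels = cong (λ L → 2 ∷ 0 ∷ 5 ∷ 4 ∷ L) (begin
    map (next t) (applyUpTo (4 +_) (3 + m))            ≡⟨ map-applyUpTo (4 +_) (next t) (3 + m) ⟩
    applyUpTo h (3 + m)                                ≡⟨ sym (applyUpTo-∷ʳ h (2 + m)) ⟩
    applyUpTo h (2 + m) ∷ʳ h (2 + m)                   ≡⟨ cong (_∷ʳ h (2 + m)) (sym (applyUpTo-∷ʳ h (1 + m))) ⟩
    (applyUpTo h (1 + m) ∷ʳ h (1 + m)) ∷ʳ h (2 + m)    ≡⟨ ++-assoc (applyUpTo h (1 + m)) (h (1 + m) ∷ []) (h (2 + m) ∷ []) ⟩
    applyUpTo h (1 + m) ++ h (1 + m) ∷ h (2 + m) ∷ []  ≡⟨ cong₂ _++_ inner-part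
                                                            (cong₂ (λ a b → a ∷ b ∷ []) (cong jump (zone-penultimate m))
                                                                                          (cong jump (zone-ultimate m))) ⟩
    applyUpTo (6 +_) (1 + m) ++ 3 ∷ 1 ∷ []             ≡⟨ cong (_++ 3 ∷ 1 ∷ []) (trans (sym (map-upTo (6 +_) (1 + m))) (map-∘ (upTo (1 + m)))) ⟩
    map suc (map (5 +_) (upTo (1 + m))) ++ 3 ∷ 1 ∷ []  ≡⟨ sym (map-++ suc (map (5 +_) (upTo (1 + m))) (2 ∷ 0 ∷ [])) ⟩
    map suc (map (5 +_) (upTo (1 + m)) ++ 2 ∷ 0 ∷ [])  ∎)
    where
    open ≡-Reasoning
    m : ℕ
    m = t + t
    h : ℕ → ℕ
    h j = jump (zone m j)
    inner-part : applyUpTo h (1 + m) ≡ applyUpTo (6 +_) (1 + m)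
    inner-part = trans (sym (map-upTo h (1 + m)))
      (trans (map-cong-local (applyUpTo⁺₁ id (1 + m) (λ j<1+m → cong jump (zone-inner (s≤s⁻¹ j<1+m)))))
             (map-upTo (6 +_) (1 + m)))

record CycleRelabelling (k : ℕ) (P : List ℕ) : Set where
  field
    q pos : ℕ → ℕ
    q-P   : map q (upTo (suc k)) ≡ swap (0 ∷ map suc P)
    orbit : OrbitRank q pos k

swap-upTo : ∀ k → 1 ≤ k → swap (upTo (suc k)) ≡ 1 ∷ 0 ∷ drop 2 (upTo (suc k))
swap-upTo (suc k) _ = refl

module FromCycle (k : ℕ) (2≤k : 2 ≤ k) (odd : isEven (suc k) ≡ false)
                 (P : List ℕ) (last-k : last (outputs (Permutations (upTo k))) ≡ just P)
                 (C : CycleRelabelling k P) where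

  open CycleRelabelling C

  U : List ℕ
  U = upTo (suc k)

  final-k : final (go k 0 (upTo k)) ≡ P
  final-k = trans (cong (λ f → final (go f 0 (upTo k))) (sym (length-upTo k)))
                  (just-injective (trans (sym (last-outputs-go (length (upTo k)) 0 (upTo k))) last-k))

  open TopCall k U (length-upTo (suc k)) 2≤k odd
  open Rounds k P final-k q q-P
  open OrbitRankProperties orbit

  head-round : ∀ c → head (iterate (round k) U c) ≡ just (fold 0 q c)
  head-round c = cong head (iterate-round c)

  length-starts : length (depthOneStarts (Permutations U)) ≡ suc k
  length-starts = trans (cong length depthOneStarts-top) (length-applyUpTo (iterate (round k) U) (suc k))

  count-starts : ∀ x → x ≤ k → length (filter (λ s → ≡-dec _≟_ (head s) (just x)) (depthOneStarts (Permutations U))) ≡ 1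
  count-starts x x≤k = trans (cong (length ∘ filter (λ s → ≡-dec _≟_ (head s) (just x))) depthOneStarts-top)
    (count-unique (λ s → ≡-dec _≟_ (head s) (just x)) (iterate (round k) U) (suc k) (pos x) (s≤s (pos-≤ x x≤k))
      (trans (head-round (pos x)) (cong just (fold-pos x x≤k)))
      (λ j j<1+k e → trans (sym (pos-fold j (s≤s⁻¹ j<1+k))) (cong pos (just-injective (trans (sym (head-round j)) e)))))

  final-last-round : final (go k 1 (iterate (round k) U k)) ≡ swap U
  final-last-round = begin
    final (go k 1 (iterate (round k) U k))    ≡⟨ sym (swap-involutive _) ⟩
    swap (round k (iterate (round k) U k))    ≡⟨ cong (swap ∘ round k) (iterate-round k) ⟩
    swap (round k (map (λ y → fold y q k) U)) ≡⟨ cong swap (round-map (λ y → fold y q k)) ⟩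
    swap (map (λ y → fold (q y) q k) U)       ≡⟨ cong swap (map-id-local (applyUpTo⁺₁ id (suc k) (λ y<1+k → fold-inverse _ (s≤s⁻¹ y<1+k)))) ⟩
    swap U                                    ∎
    where open ≡-Reasoning

  last-top : last (outputs (Permutations U)) ≡ just (1 ∷ 0 ∷ drop 2 U)
  last-top = trans (last-outputs-go (length U) 0 U)
    (cong just (trans final-top (trans final-last-round (swap-upTo k (<⇒≤ 2≤k)))))

isEven-suc-even : ∀ {k} → 2 ∣ k → isEven (suc k) ≡ false
isEven-suc-even (divides m refl) = odd m
  where
  odd : ∀ m → isEven (suc (m * 2)) ≡ false
  odd zero    = refl
  odd (suc m) = odd m

cycleRelabelling : ∀ {k} → 4 < k → 2 ∣ k → CycleRelabelling k (1 ∷ 4 ∷ 3 ∷ (map (5 +_) (upTo (k ∸ 5)) ++ 2 ∷ 0 ∷ []))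
cycleRelabelling (s≤s (s≤s (s≤s (s≤s (s≤s _))))) (divides (suc (suc (suc t))) refl) rewrite *-comm t 2 | +-identityʳ t =
  record { q = next t ; pos = rank t ; q-P = next-relabels t ; orbit = next-orbitRank t }

lemma2 : (k : ℕ) → 4 < k → 2 ∣ k →
    last (outputs (Permutations (upTo k)))
      ≡ just (1 ∷ 4 ∷ 3 ∷ (map (5 +_) (upTo (k ∸ 5)) ++ 2 ∷ 0 ∷ [])) →
    (length (depthOneStarts (Permutations (upTo (suc k)))) ≡ suc k
      × ((x : ℕ) → x ≤ k →
          length (filter (λ s → ≡-dec _≟_ (head s) (just x))
                   (depthOneStarts (Permutations (upTo (suc k))))) ≡ 1))
    × last (outputs (Permutations (upTo (suc k))))
        ≡ just (1 ∷ 0 ∷ drop 2 (upTo (suc k)))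
lemma2 k 4<k 2∣k last-k = (length-starts , count-starts) , last-top
  where open FromCycle k (≤-trans (s≤s (s≤s z≤n)) (<⇒≤ 4<k)) (isEven-suc-even 2∣k) _ last-k (cycleRelabelling 4<k 2∣k)
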